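{- Let $\iota\colon\mathbf{A}\hookrightarrow\mathbf{A}^{\Delta}$ be a commutative complemented Dedekind--MacNeille completion of a commutative bimonoid $\mathbf{A}$. Then the following are equivalent: (i) each join which exists in $\mathbf{A}$ is admissible; (ii) $\iota$ preserves all joins which exist in $\mathbf{A}$; (iii) some embedding of $\mathbf{A}$ into a commutative complete complemented bimonoid preserves all joins which exist in $\mathbf{A}$.
   Context: A bimonoid $\langle A,\leq,\cdot,1,+,0\rangle$ is a poset with two monoid structures ($\cdot$ with unit $1$, $+$ with unit $0$), both operations order preserving in each argument, satisfying hemidistributivity $x\cdot(y+z)\leq(x\cdot y)+z$ and $(z+y)\cdot x\leq z+(y\cdot x)$; commutative if both operations are commutative. Homomorphisms preserve order, $\cdot,1,+,0$; embeddings are homomorphisms that are order embeddings. A join $\bigvee X$ existing in $\mathbf{A}$ is admissible if $(\bigvee X)\cdot y=\bigvee\{x\cdot y:x\in X\}$ for all $y\in\mathbf{A}$. In a commutative bimonoid, $y$ is a complement of $x$ if $x\cdot y\leq 0$ and $1\leq x+y$; unique if it exists, written $\overline{x}$; complemented means every element has a complement; complete means the order is a complete lattice. An embedding $e\colon\mathbf{A}\hookrightarrow\mathbf{C}$ of commutative bimonoids is a commutative $\Delta_1$-extension if the elements $e(a)\cdot\overline{e(b)}$ ($a,b\in\mathbf{A}$, complement existing in $\mathbf{C}$) are join dense and the elements $e(a)+\overline{e(b)}$ are meet dense in $\mathbf{C}$; it is a commutative complemented Dedekind--MacNeille completion if moreover $\mathbf{C}$ is complete and complemented. -}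

module Defs where

open import Level using (Level; suc; _⊔_)
open import Data.Product using (Σ; ∃; ∃-syntax; _×_; _,_)
open import Relation.Unary using (Pred)
open import Relation.Binary.PropositionalEquality using (_≡_)
open import Relation.Binary.Structures using (IsPartialOrder)
open import Algebra.Structures using (IsCommutativeMonoid)

record CBimonoid (o : Level) : Set (suc o) where
  infixl 7 _·_
  infixl 6 _+_
  infix 4 _≤_
  field
    Carrier : Set o
    _≤_ : Carrier → Carrier → Set o
    isPartialOrder : IsPartialOrder _≡_ _≤_
    _·_ : Carrier → Carrier → Carrier
    1# : Carrier
    _+_ : Carrier → Carrier → Carrier
    0# : Carrier
    ·-isCommutativeMonoid : IsCommutativeMonoid _≡_ _·_ 1#
    +-isCommutativeMonoid : IsCommutativeMonoid _≡_ _+_ 0#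
    ·-mono : ∀ {x x′ y y′} → x ≤ x′ → y ≤ y′ → x · y ≤ x′ · y′
    +-mono : ∀ {x x′ y y′} → x ≤ x′ → y ≤ y′ → x + y ≤ x′ + y′
    hemiˡ : ∀ x y z → x · (y + z) ≤ (x · y) + z
    hemiʳ : ∀ x y z → (z + y) · x ≤ z + (y · x)

module _ {o : Level} (M : CBimonoid o) where
  open CBimonoid M

  IsUpperBound : Pred Carrier o → Carrier → Set o
  IsUpperBound X u = ∀ x → X x → x ≤ u

  IsLowerBound : Pred Carrier o → Carrier → Set o
  IsLowerBound X l = ∀ x → X x → l ≤ x

  IsJoin : Pred Carrier o → Carrier → Set o
  IsJoin X j = IsUpperBound X j × (∀ u → IsUpperBound X u → j ≤ u)

  IsMeet : Pred Carrier o → Carrier → Set o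
  IsMeet X m = IsLowerBound X m × (∀ l → IsLowerBound X l → l ≤ m)

  MulRight : Pred Carrier o → Carrier → Pred Carrier o
  MulRight X y z = ∃[ x ] (X x × z ≡ x · y)

  IsAdmissibleJoin : Pred Carrier o → Carrier → Set o
  IsAdmissibleJoin X j = ∀ y → IsJoin (MulRight X y) (j · y)

  AllJoinsAdmissible : Set (suc o)
  AllJoinsAdmissible = ∀ (X : Pred Carrier o) j → IsJoin X j → IsAdmissibleJoin X j

  IsComplement : Carrier → Carrier → Set o
  IsComplement x y = (x · y ≤ 0#) × (1# ≤ x + y)

  Complemented : Set o
  Complemented = ∀ x → ∃[ y ] IsComplement x y

  Complete : Set (suc o)
  Complete = ∀ (X : Pred Carrier o) → ∃[ j ] IsJoin X j

record Embedding {o : Level} (A C : CBimonoid o) : Set o where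
  module A = CBimonoid A
  module C = CBimonoid C
  field
    f : A.Carrier → C.Carrier
    mono : ∀ {x y} → x A.≤ y → f x C.≤ f y
    reflect : ∀ {x y} → f x C.≤ f y → x A.≤ y
    pres-· : ∀ x y → f (x A.· y) ≡ f x C.· f y
    pres-1 : f A.1# ≡ C.1#
    pres-+ : ∀ x y → f (x A.+ y) ≡ f x C.+ f y
    pres-0 : f A.0# ≡ C.0#

module _ {o : Level} {A C : CBimonoid o} (e : Embedding A C) where
  private
    module A = CBimonoid A
    module C = CBimonoid C
  open Embedding e using (f)

  Image : Pred A.Carrier o → Pred C.Carrier o
  Image X c = ∃[ x ] (X x × c ≡ f x)

  PreservesJoins : Set (suc o)
  PreservesJoins = ∀ (X : Pred A.Carrier o) j → IsJoin A X j → IsJoin C (Image X) (f j)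

  ProdGen : C.Carrier → Set o
  ProdGen d = ∃[ a ] ∃[ b ] ∃[ b′ ] (IsComplement C (f b) b′ × d ≡ f a C.· b′)

  SumGen : C.Carrier → Set o
  SumGen d = ∃[ a ] ∃[ b ] ∃[ b′ ] (IsComplement C (f b) b′ × d ≡ f a C.+ b′)

  JoinDense : Set o
  JoinDense = ∀ c → IsJoin C (λ d → ProdGen d × d C.≤ c) c

  MeetDense : Set o
  MeetDense = ∀ c → IsMeet C (λ d → SumGen d × c C.≤ d) c

  IsCommΔ₁Extension : Set o
  IsCommΔ₁Extension = JoinDense × MeetDense

  IsCommComplementedDMCompletion : Set (suc o)
  IsCommComplementedDMCompletion = IsCommΔ₁Extension × Complete C × Complemented C

{-# OPTIONS --safe #-}
module Submission where

-- A complement ȳ of y makes multiplication by y residuated: z · y ≤ w iff z ≤ w + ȳ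
-- (hemidistributivity in both directions). Along an embedding e this turns x · b ≤ a
-- in A into e x ≤ e a + ‾(e b), a bound on e x alone. So admissibility of ⋁X is
-- exactly what puts e(⋁X) below every meet-dense generator e a + ‾(e b) lying above
-- e[X]; conversely, a join-preserving embedding into a complemented bimonoid
-- transports admissibility back to A.

open import Defs
open import Level using (Level)
open import Data.Product using (Σ; ∃-syntax; _×_; _,_; proj₁; proj₂)
open import Function.Bundles using (_⇔_; mk⇔; Equivalence)
open import Relation.Binary.Bundles using (Poset)
open import Relation.Binary.PropositionalEquality using (refl; sym; cong)
open import Algebra.Structures using (IsCommutativeMonoid)
import Relation.Binary.Reasoning.PartialOrder as PosetReasoning

module BimonoidProperties {o : Level} (M : CBimonoid o) where
  open CBimonoid M

  poset : Poset o o o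
  poset = record { isPartialOrder = isPartialOrder }

  open Poset poset public using () renaming (refl to ≤-refl; trans to ≤-trans; reflexive to ≤-reflexive)
  open PosetReasoning poset

  open IsCommutativeMonoid ·-isCommutativeMonoid using ()
    renaming (comm to ·-comm; identityʳ to ·-identityʳ)
  open IsCommutativeMonoid +-isCommutativeMonoid using ()
    renaming (comm to +-comm; identityʳ to +-identityʳ)

  complement-residuation : ∀ {x y z w} → IsComplement M x y → (z · x ≤ w ⇔ z ≤ w + y)
  complement-residuation {x} {y} {z} {w} (xy≤0 , 1≤x+y) = mk⇔ to from
    where
    to : z · x ≤ w → z ≤ w + y
    to zx≤w = begin
      z             ≡⟨ sym (·-identityʳ z) ⟩
      z · 1#        ≤⟨ ·-mono ≤-refl 1≤x+y ⟩
      z · (x + y)   ≤⟨ hemiˡ z x y ⟩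
      z · x + y     ≤⟨ +-mono zx≤w ≤-refl ⟩
      w + y         ∎
    from : z ≤ w + y → z · x ≤ w
    from z≤w+y = begin
      z · x         ≤⟨ ·-mono z≤w+y ≤-refl ⟩
      (w + y) · x   ≤⟨ hemiʳ x y w ⟩
      w + y · x     ≡⟨ cong (w +_) (·-comm y x) ⟩
      w + x · y     ≤⟨ +-mono ≤-refl xy≤0 ⟩
      w + 0#        ≡⟨ +-identityʳ w ⟩
      w             ∎

  upperBound-MulRight : ∀ {X j} y → IsUpperBound M X j → IsUpperBound M (MulRight M X y) (j · y)
  upperBound-MulRight y ub _ (x , x∈X , refl) = ·-mono (ub x x∈X) ≤-refl

module EmbeddingProperties {o : Level} {A C : CBimonoid o} (e : Embedding A C) where
  open Embedding e using (f; mono; reflect; pres-·)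
  private
    module A = CBimonoid A
    module C = CBimonoid C
    module PC = BimonoidProperties C

  embedded-residuation : ∀ {a b b′ x} → IsComplement C (f b) b′ →
                         (f x C.≤ f a C.+ b′ ⇔ x A.· b A.≤ a)
  embedded-residuation {a} {b} {b′} {x} cb = mk⇔
    (λ fx≤ → reflect (PC.≤-trans (PC.≤-reflexive (pres-· x b)) (Equivalence.from residuation fx≤)))
    (λ xb≤a → Equivalence.to residuation (PC.≤-trans (PC.≤-reflexive (sym (pres-· x b))) (mono xb≤a)))
    where
    residuation : f x C.· f b C.≤ f a ⇔ f x C.≤ f a C.+ b′
    residuation = PC.complement-residuation cb

  upperBound-Image : ∀ {X j} → IsUpperBound A X j → IsUpperBound C (Image e X) (f j)
  upperBound-Image ub _ (x , x∈X , refl) = mono (ub x x∈X)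

  preservesJoins⇒allJoinsAdmissible : Complemented C → PreservesJoins e → AllJoinsAdmissible A
  preservesJoins⇒allJoinsAdmissible complemented preserves X j isJoin y =
    BimonoidProperties.upperBound-MulRight A y (proj₁ isJoin) , least (complemented (f y))
    where
    least : ∃[ y′ ] IsComplement C (f y) y′ → ∀ u → IsUpperBound A (MulRight A X y) u → j A.· y A.≤ u
    least (y′ , cy) u ub = Equivalence.to (embedded-residuation cy)
      (proj₂ (preserves X j isJoin) (f u C.+ y′) λ where
        _ (x , x∈X , refl) → Equivalence.from (embedded-residuation cy) (ub (x A.· y) (x , x∈X , refl)))

  allJoinsAdmissible⇒preservesJoins : MeetDense e → AllJoinsAdmissible A → PreservesJoins e
  allJoinsAdmissible⇒preservesJoins meetDense admissible X j isJoin =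
    upperBound-Image (proj₁ isJoin) , least
    where
    least : ∀ u → IsUpperBound C (Image e X) u → f j C.≤ u
    least u ub = proj₂ (meetDense u) (f j) λ where
      _ ((a , b , b′ , cb , refl) , u≤d) → Equivalence.from (embedded-residuation cb)
        (proj₂ (admissible X j isJoin b) a λ where
          _ (x , x∈X , refl) → Equivalence.to (embedded-residuation cb)
            (PC.≤-trans (ub (f x) (x , x∈X , refl)) u≤d))

open EmbeddingProperties

mainTheorem9 : {o : Level} (A AΔ : CBimonoid o) (ι : Embedding A AΔ) →
    IsCommComplementedDMCompletion ι →
    (AllJoinsAdmissible A ⇔ PreservesJoins ι) ×
    (PreservesJoins ι ⇔
      (∃[ C ] Σ (Embedding A C) λ e → Complete C × Complemented C × PreservesJoins e))
mainTheorem9 A AΔ ι ((_ , meetDense) , complete , complemented) =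
    mk⇔ i⇒ii (preservesJoins⇒allJoinsAdmissible ι complemented)
  , mk⇔ (λ preserves → AΔ , ι , complete , complemented , preserves)
        (λ (C , e , _ , complementedC , preserves) →
           i⇒ii (preservesJoins⇒allJoinsAdmissible e complementedC preserves))
  where
  i⇒ii : AllJoinsAdmissible A → PreservesJoins ι
  i⇒ii = allJoinsAdmissible⇒preservesJoins ι meetDense
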